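{- Let $P,Q\in\mathsf{nCSP}$. If $[\![P]\!]=[\![Q]\!]$ (as distributions over state-based terms) then $P=_{\mathrm{prob}}Q$.
   Context: Let $\mathsf{Act}$ be a finite set of actions. $\mathsf{nCSP}$ terms: $P::=S\mid P\oplus_pP$ ($0<p<1$), $S::=\mathbf 0\mid a.P\ (a\in\mathsf{Act})\mid P\sqcap P\mid S\Box S$; terms of sort $S$ are state-based; $P\Box Q$ for non-state-based $P,Q$ abbreviates distributing $\Box$ over $\oplus_p$. A distribution over state-based terms is a finitely supported probability function; $[\![s]\!]$ is the point distribution on $s$ for state-based $s$, and $[\![P\oplus_pQ]\!]=p\cdot[\![P]\!]+(1-p)\cdot[\![Q]\!]$ (pointwise). $P=_{\mathrm{prob}}Q$ means $P=Q$ is derivable in equational logic (reflexivity, symmetry, transitivity, substitution instances, closure under all operators) from only the axioms (P1) $P\oplus_pP=P$; (P2) $P\oplus_pQ=Q\oplus_{1-p}P$; (P3) $(P\oplus_pQ)\oplus_qR=P\oplus_{p\cdot q}(Q\oplus_{\frac{(1-p)q}{1-pq}}R)$; (D1) $P\Box(Q\oplus_pR)=(P\Box Q)\oplus_p(P\Box R)$.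
   Formalization: The probabilities p in $P\oplus_pQ$ range over the rationals strictly between 0 and 1. -}

module Defs where

open import Data.Nat using (ℕ)
open import Data.Fin using (Fin)
import Data.Fin as Fin
open import Data.Bool using (Bool; true; false; _∧_; if_then_else_)
open import Data.Rational using (ℚ; 0ℚ; 1ℚ; _+_; _*_; _-_; _<_; _÷_; NonZero)
import Data.Rational.Properties as ℚP
open import Relation.Nullary using (does)
open import Relation.Binary.PropositionalEquality using (_≡_)

-- Probabilities p with 0 < p < 1 (bounds are irrelevant, so two
-- probabilities are equal iff their values are equal).
record Prob : Set where
  constructor prob
  field
    val : ℚ
    .pos : 0ℚ < val
    .lt1 : val < 1ℚ
open Prob public

-- Terms over the full signature of nCSP; the set of actions Act is Fin n.
infixr 5 _⊕[_]_
infixl 6 _□_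
infixl 6 _⊓_
data Term (n : ℕ) : Set where
  𝟎     : Term n
  _∙_   : Fin n → Term n → Term n
  _⊓_   : Term n → Term n → Term n
  _□_   : Term n → Term n → Term n
  _⊕[_]_ : Term n → Prob → Term n → Term n

mutual
  data IsState {n : ℕ} : Term n → Set where
    st-nil  : IsState 𝟎
    st-pre  : ∀ {a P} → IsProc P → IsState (a ∙ P)
    st-int  : ∀ {P Q} → IsProc P → IsProc Q → IsState (P ⊓ Q)
    st-ext  : ∀ {S T} → IsState S → IsState T → IsState (S □ T)

  data IsProc {n : ℕ} : Term n → Set where
    pr-st   : ∀ {S} → IsState S → IsProc S
    pr-prob : ∀ {P Q p} → IsProc P → IsProc Q → IsProc (P ⊕[ p ] Q)

eqb : ∀ {n} → Term n → Term n → Bool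
eqb 𝟎 𝟎 = true
eqb (a ∙ P) (b ∙ Q) = does (a Fin.≟ b) ∧ eqb P Q
eqb (P ⊓ Q) (P' ⊓ Q') = eqb P P' ∧ eqb Q Q'
eqb (P □ Q) (P' □ Q') = eqb P P' ∧ eqb Q Q'
eqb (P ⊕[ p ] Q) (P' ⊕[ p' ] Q') = does (val p ℚP.≟ val p') ∧ eqb P P' ∧ eqb Q Q'
eqb _ _ = false

⟦_⟧ : ∀ {n} → Term n → Term n → ℚ
⟦ P ⊕[ p ] Q ⟧ s = val p * ⟦ P ⟧ s + (1ℚ - val p) * ⟦ Q ⟧ s
⟦ 𝟎 ⟧ s = if eqb 𝟎 s then 1ℚ else 0ℚ
⟦ a ∙ P ⟧ s = if eqb (a ∙ P) s then 1ℚ else 0ℚ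
⟦ P ⊓ Q ⟧ s = if eqb (P ⊓ Q) s then 1ℚ else 0ℚ
⟦ P □ Q ⟧ s = if eqb (P □ Q) s then 1ℚ else 0ℚ

infix 4 _=prob_
data _=prob_ {n : ℕ} : Term n → Term n → Set where
  refl'  : ∀ {P} → P =prob P
  sym'   : ∀ {P Q} → P =prob Q → Q =prob P
  trans' : ∀ {P Q R} → P =prob Q → Q =prob R → P =prob R
  c-pre  : ∀ {a P Q} → P =prob Q → (a ∙ P) =prob (a ∙ Q)
  c-int  : ∀ {P P' Q Q'} → P =prob P' → Q =prob Q' → (P ⊓ Q) =prob (P' ⊓ Q')
  c-ext  : ∀ {P P' Q Q'} → P =prob P' → Q =prob Q' → (P □ Q) =prob (P' □ Q')
  c-prob : ∀ {P P' Q Q'} (p : Prob) → P =prob P' → Q =prob Q' →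
           (P ⊕[ p ] Q) =prob (P' ⊕[ p ] Q')
  P1 : ∀ {P} (p : Prob) → (P ⊕[ p ] P) =prob P
  P2 : ∀ {P Q} (p q : Prob) → val q ≡ 1ℚ - val p →
       (P ⊕[ p ] Q) =prob (Q ⊕[ q ] P)
  P3 : ∀ {P Q R} (p q r s : Prob) .{{_ : NonZero (1ℚ - val p * val q)}} →
       val r ≡ val p * val q →
       val s ≡ ((1ℚ - val p) * val q) ÷ (1ℚ - val p * val q) →
       ((P ⊕[ p ] Q) ⊕[ q ] R) =prob (P ⊕[ r ] (Q ⊕[ s ] R))
  D1 : ∀ {P Q R} (p : Prob) → (P □ (Q ⊕[ p ] R)) =prob ((P □ Q) ⊕[ p ] (P □ R))

module Submission where

-- Only (P1)-(P3) and congruence for ⊕ are used (not (D1) nor the other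
-- congruences), so we work with the smaller relation _≈_ of "convex
-- equality", which is sound for ⟦_⟧ and embeds into _=prob_.
--
-- Fix a state s occurring as a leaf of P.  Every process X splits at s:
-- either s does not occur in X (weight 0), or X ≈ s (weight 1), or
-- X ≈ s ⊕_w X' with s absent from X' and X' having fewer leaves than X
-- (weight w).  The weight is ⟦ X ⟧ s, so P and Q split in the same way
-- with the same weight; in the interesting case P ≈ s ⊕_w P' and
-- Q ≈ s ⊕_w Q', cancelling the common summand gives ⟦ P' ⟧ = ⟦ Q' ⟧, and
-- we conclude by well-founded induction on the number of leaves of P.
-- Splits of P ⊕_p Q are assembled from splits of P and Q using a few
-- derived convex laws about the predicate "Z ≈ s ⊕_w Y for some w".

open import Defs
open import Data.Nat using (ℕ)
open import Relation.Binary.PropositionalEquality using (_≡_)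

open import Data.Bool using (true; false; _∧_; if_then_else_)
open import Data.Empty using (⊥; ⊥-elim)
open import Data.Product using (Σ; _×_; _,_)
import Data.Fin as Fin
import Data.Nat as ℕ
import Data.Nat.Properties as ℕP
open import Data.Nat.Induction using (<-wellFounded)
open import Induction.WellFounded using (Acc; acc)
open import Data.Rational
  using (ℚ; 0ℚ; 1ℚ; _+_; _*_; _-_; _<_; _÷_; -_; 1/_; NonZero; positive; >-nonZero)
import Data.Rational.Properties as ℚP
open import Data.Rational.Solver using (module +-*-Solver)
open +-*-Solver using (solve; _:+_; _:*_; _:-_; con; _:=_)
import Algebra.Properties.Group ℚP.+-0-group as ℚ+
open import Relation.Nullary using (¬_; Dec; yes; does)
open import Relation.Nullary.Decidable using (recompute; dec-true)
open import Relation.Binary.Bundles using (Setoid)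
open import Level using (0ℓ)
open import Relation.Binary.PropositionalEquality
  using (_≢_; refl; sym; trans; cong; cong₂; subst; subst₂; module ≡-Reasoning)

-- Rational arithmetic on the open unit interval, needed to show that the
-- complement, the product and the (P3) coefficient are again probabilities.

1-p-pos : ∀ {p} → p < 1ℚ → 0ℚ < 1ℚ - p
1-p-pos {p} p<1 = subst (_< 1ℚ - p) (ℚP.+-inverseʳ p) (ℚP.+-monoˡ-< (- p) p<1)

1-p<1 : ∀ {p} → 0ℚ < p → 1ℚ - p < 1ℚ
1-p<1 {p} p>0 =
  subst (1ℚ - p <_) (ℚP.+-identityʳ 1ℚ) (ℚP.+-monoʳ-< 1ℚ (ℚP.neg-antimono-< p>0))

*-pos : ∀ {p q} → 0ℚ < p → 0ℚ < q → 0ℚ < p * q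
*-pos {p} {q} p>0 q>0 =
  subst (_< p * q) (ℚP.*-zeroˡ q) (ℚP.*-monoˡ-<-pos q {{positive q>0}} p>0)

*-<1 : ∀ {p q} → p < 1ℚ → 0ℚ < q → q < 1ℚ → p * q < 1ℚ
*-<1 {p} {q} p<1 q>0 q<1 =
  ℚP.<-trans (subst (p * q <_) (ℚP.*-identityˡ q) (ℚP.*-monoˡ-<-pos q {{positive q>0}} p<1)) q<1

÷-* : ∀ a b .{{_ : NonZero b}} → (a ÷ b) * b ≡ a
÷-* a b = trans (ℚP.*-assoc a (1/ b) b) (trans (cong (a *_) (ℚP.*-inverseˡ b)) (ℚP.*-identityʳ a))

÷-pos : ∀ a b (a>0 : 0ℚ < a) (b>0 : 0ℚ < b) → 0ℚ < _÷_ a b {{>-nonZero b>0}}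
÷-pos a b a>0 b>0 = ℚP.*-cancelʳ-<-nonNeg b {{ℚP.pos⇒nonNeg b {{positive b>0}}}}
  (subst₂ _<_ (sym (ℚP.*-zeroˡ b)) (sym (÷-* a b {{>-nonZero b>0}})) a>0)

÷-<1 : ∀ a b (b>0 : 0ℚ < b) → a < b → _÷_ a b {{>-nonZero b>0}} < 1ℚ
÷-<1 a b b>0 a<b = ℚP.*-cancelʳ-<-nonNeg b {{ℚP.pos⇒nonNeg b {{positive b>0}}}}
  (subst₂ _<_ (sym (÷-* a b {{>-nonZero b>0}})) (sym (ℚP.*-identityˡ b)) a<b)

1≢0 : 1ℚ ≢ 0ℚ
1≢0 ()

*-cancelˡ-nonZero : ∀ c x y .{{_ : NonZero c}} → c * x ≡ c * y → x ≡ y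
*-cancelˡ-nonZero c x y cx≡cy = begin
  x                ≡⟨ sym (ℚP.*-identityˡ x) ⟩
  1ℚ * x           ≡⟨ cong (_* x) (sym (ℚP.*-inverseˡ c)) ⟩
  (1/ c * c) * x   ≡⟨ ℚP.*-assoc (1/ c) c x ⟩
  1/ c * (c * x)   ≡⟨ cong (1/ c *_) cx≡cy ⟩
  1/ c * (c * y)   ≡⟨ sym (ℚP.*-assoc (1/ c) c y) ⟩
  (1/ c * c) * y   ≡⟨ cong (_* y) (ℚP.*-inverseˡ c) ⟩
  1ℚ * y           ≡⟨ ℚP.*-identityˡ y ⟩
  y                ∎
  where open ≡-Reasoning

-- Probabilities: the bounds are irrelevant fields, recomputed when needed.

prob-pos : (p : Prob) → 0ℚ < val p
prob-pos (prob v p>0 _) = recompute (0ℚ ℚP.<? v) p>0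

prob-<1 : (p : Prob) → val p < 1ℚ
prob-<1 (prob v _ p<1) = recompute (v ℚP.<? 1ℚ) p<1

prob-ext : ∀ {p q : Prob} → val p ≡ val q → p ≡ q
prob-ext {prob v _ _} {prob .v _ _} refl = refl

prob≢0 : (p : Prob) → val p ≢ 0ℚ
prob≢0 p p≡0 = ℚP.<-irrefl (sym p≡0) (prob-pos p)

prob≢1 : (p : Prob) → val p ≢ 1ℚ
prob≢1 p p≡1 = ℚP.<-irrefl p≡1 (prob-<1 p)

-- The complement 1 - p, the product p·q, and the inner weight
-- (1-p)q/(1-pq) of axiom (P3).

infix  8 _ᶜ
infixl 7 _·_

_ᶜ : Prob → Prob
p ᶜ = prob (1ℚ - val p) (1-p-pos (prob-<1 p)) (1-p<1 (prob-pos p))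

_·_ : Prob → Prob → Prob
p · q = prob (val p * val q) (*-pos (prob-pos p) (prob-pos q))
  (*-<1 (prob-<1 p) (prob-pos q) (prob-<1 q))

1-pq-pos : ∀ p q → 0ℚ < 1ℚ - val p * val q
1-pq-pos p q = 1-p-pos (prob-<1 (p · q))

1-pq≢0 : ∀ p q → NonZero (1ℚ - val p * val q)
1-pq≢0 p q = >-nonZero (1-pq-pos p q)

σ : Prob → Prob → Prob
σ p q = prob (_÷_ ((1ℚ - val p) * val q) (1ℚ - val p * val q) {{1-pq≢0 p q}})
  (÷-pos _ _ (*-pos (1-p-pos (prob-<1 p)) (prob-pos q)) (1-pq-pos p q))
  (÷-<1 _ _ (1-pq-pos p q) numerator<denominator)
  where
  numerator<denominator : (1ℚ - val p) * val q < 1ℚ - val p * val q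
  numerator<denominator = subst (_< 1ℚ - val p * val q)
    (solve 2 (λ p q → q :- p :* q := (con 1ℚ :- p) :* q) refl (val p) (val q))
    (ℚP.+-monoˡ-< (- (val p * val q)) (prob-<1 q))

-- Convex equality: the equations derivable from (P1)-(P3) using only
-- congruence for ⊕.  It is the part of _=prob_ that is sound for ⟦_⟧.

infix 4 _≈_
data _≈_ {n : ℕ} : Term n → Term n → Set where
  ≈-refl  : ∀ {P} → P ≈ P
  ≈-sym   : ∀ {P Q} → P ≈ Q → Q ≈ P
  ≈-trans : ∀ {P Q R} → P ≈ Q → Q ≈ R → P ≈ R
  ⊕-cong  : ∀ {P P' Q Q'} (p : Prob) → P ≈ P' → Q ≈ Q' → P ⊕[ p ] Q ≈ P' ⊕[ p ] Q'
  ax-P1   : ∀ {P} (p : Prob) → P ⊕[ p ] P ≈ P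
  ax-P2   : ∀ {P Q} (p q : Prob) → val q ≡ 1ℚ - val p → P ⊕[ p ] Q ≈ Q ⊕[ q ] P
  ax-P3   : ∀ {P Q R} (p q r s : Prob) .{{_ : NonZero (1ℚ - val p * val q)}} →
            val r ≡ val p * val q →
            val s ≡ ((1ℚ - val p) * val q) ÷ (1ℚ - val p * val q) →
            (P ⊕[ p ] Q) ⊕[ q ] R ≈ P ⊕[ r ] (Q ⊕[ s ] R)

≈⇒=prob : ∀ {n} {P Q : Term n} → P ≈ Q → P =prob Q
≈⇒=prob ≈-refl = refl'
≈⇒=prob (≈-sym d) = sym' (≈⇒=prob d)
≈⇒=prob (≈-trans d e) = trans' (≈⇒=prob d) (≈⇒=prob e)
≈⇒=prob (⊕-cong p d e) = c-prob p (≈⇒=prob d) (≈⇒=prob e)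
≈⇒=prob (ax-P1 p) = P1 p
≈⇒=prob (ax-P2 p q q≡1-p) = P2 p q q≡1-p
≈⇒=prob (ax-P3 p q r s r≡pq s≡σ) = P3 p q r s r≡pq s≡σ

≈-setoid : ℕ → Setoid 0ℓ 0ℓ
≈-setoid n = record
  { Carrier = Term n
  ; _≈_ = _≈_
  ; isEquivalence = record { refl = ≈-refl ; sym = ≈-sym ; trans = ≈-trans }
  }

-- The rational identity behind soundness of (P3), given S(1-pq) = (1-p)q.
P3-identity : ∀ p q S x y z → S * (1ℚ - p * q) ≡ (1ℚ - p) * q →
  q * (p * x + (1ℚ - p) * y) + (1ℚ - q) * z
    ≡ p * q * x + (1ℚ - p * q) * (S * y + (1ℚ - S) * z)
P3-identity p q S x y z S[1-pq]≡[1-p]q = begin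
  q * (p * x + (1ℚ - p) * y) + (1ℚ - q) * z
    ≡⟨ solve 5 (λ p q x y z →
         q :* (p :* x :+ (con 1ℚ :- p) :* y) :+ (con 1ℚ :- q) :* z
         := p :* q :* x :+ ((con 1ℚ :- p) :* q) :* y
            :+ ((con 1ℚ :- p :* q) :- (con 1ℚ :- p) :* q) :* z) refl p q x y z ⟩
  p * q * x + ((1ℚ - p) * q) * y + ((1ℚ - p * q) - (1ℚ - p) * q) * z
    ≡⟨ cong (λ u → p * q * x + u * y + ((1ℚ - p * q) - u) * z) (sym S[1-pq]≡[1-p]q) ⟩
  p * q * x + (S * (1ℚ - p * q)) * y + ((1ℚ - p * q) - S * (1ℚ - p * q)) * z
    ≡⟨ solve 6 (λ p q S x y z →
         p :* q :* x :+ (S :* (con 1ℚ :- p :* q)) :* y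
           :+ ((con 1ℚ :- p :* q) :- S :* (con 1ℚ :- p :* q)) :* z
         := p :* q :* x :+ (con 1ℚ :- p :* q) :* (S :* y :+ (con 1ℚ :- S) :* z)) refl p q S x y z ⟩
  p * q * x + (1ℚ - p * q) * (S * y + (1ℚ - S) * z)
    ∎
  where open ≡-Reasoning

≈-sound : ∀ {n} {P Q : Term n} → P ≈ Q → ∀ t → ⟦ P ⟧ t ≡ ⟦ Q ⟧ t
≈-sound ≈-refl t = refl
≈-sound (≈-sym d) t = sym (≈-sound d t)
≈-sound (≈-trans d e) t = trans (≈-sound d t) (≈-sound e t)
≈-sound (⊕-cong p d e) t =
  cong₂ (λ a b → val p * a + (1ℚ - val p) * b) (≈-sound d t) (≈-sound e t)
≈-sound {P = P ⊕[ _ ] _} (ax-P1 p) t =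
  solve 2 (λ p x → p :* x :+ (con 1ℚ :- p) :* x := x) refl (val p) (⟦ P ⟧ t)
≈-sound {P = P ⊕[ _ ] Q} (ax-P2 p q q≡1-p) t rewrite q≡1-p =
  solve 3 (λ p x y → p :* x :+ (con 1ℚ :- p) :* y
                     := (con 1ℚ :- p) :* y :+ (con 1ℚ :- (con 1ℚ :- p)) :* x)
    refl (val p) (⟦ P ⟧ t) (⟦ Q ⟧ t)
≈-sound {P = (P ⊕[ _ ] Q) ⊕[ _ ] R} (ax-P3 p q r s r≡pq s≡σ) t rewrite r≡pq | s≡σ =
  P3-identity (val p) (val q) (_÷_ ((1ℚ - val p) * val q) (1ℚ - val p * val q) {{1-pq≢0 p q}})
    (⟦ P ⟧ t) (⟦ Q ⟧ t) (⟦ R ⟧ t) (÷-* ((1ℚ - val p) * val q) (1ℚ - val p * val q) {{1-pq≢0 p q}})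

⊕-swap : ∀ {n} {X Y : Term n} p → X ⊕[ p ] Y ≈ Y ⊕[ p ᶜ ] X
⊕-swap p = ax-P2 p (p ᶜ) refl

⊕-assoc : ∀ {n} {X Y Z : Term n} p q →
  (X ⊕[ p ] Y) ⊕[ q ] Z ≈ X ⊕[ p · q ] (Y ⊕[ σ p q ] Z)
⊕-assoc p q = ax-P3 p q (p · q) (σ p q) {{1-pq≢0 p q}} refl refl

Mix : ∀ {n} → Term n → Term n → Term n → Set
Mix s Y Z = Σ Prob λ w → Z ≈ s ⊕[ w ] Y

module _ {n : ℕ} {s : Term n} where
  open import Relation.Binary.Reasoning.Setoid (≈-setoid n)

  mix-resp : ∀ {X Y Z} → X ≈ Z → Mix s Y Z → Mix s Y X
  mix-resp X≈Z (w , Z≈s⊕Y) = w , ≈-trans X≈Z Z≈s⊕Y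

  mix-left : ∀ {A B Z} p → Mix s A Z → Σ Prob λ u → Mix s (A ⊕[ u ] B) (Z ⊕[ p ] B)
  mix-left p (w , Z≈s⊕A) = σ w p , w · p , ≈-trans (⊕-cong p Z≈s⊕A ≈-refl) (⊕-assoc w p)

  mix-right : ∀ {A B Z} p → Mix s B Z → Σ Prob λ u → Mix s (A ⊕[ u ] B) (A ⊕[ p ] Z)
  mix-right {A} {B} {Z} p mB =
    let (u , w , Z⊕A≈s⊕[B⊕A]) = mix-left {B = A} (p ᶜ) mB
    in u ᶜ , w , (begin
      A ⊕[ p ] Z              ≈⟨ ⊕-swap p ⟩
      Z ⊕[ p ᶜ ] A            ≈⟨ Z⊕A≈s⊕[B⊕A] ⟩
      s ⊕[ w ] (B ⊕[ u ] A)   ≈⟨ ⊕-cong w ≈-refl (⊕-swap u) ⟩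
      s ⊕[ w ] (A ⊕[ u ᶜ ] B) ∎)

  absorb : ∀ {Y Z} p → Mix s Y Z → Mix s Y (s ⊕[ p ] Z)
  absorb {Y} {Z} p (v , Z≈s⊕Y) = (v ᶜ · p ᶜ) ᶜ , (begin
    s ⊕[ p ] Z                              ≈⟨ ⊕-cong p ≈-refl Z≈s⊕Y ⟩
    s ⊕[ p ] (s ⊕[ v ] Y)                   ≈⟨ ⊕-swap p ⟩
    (s ⊕[ v ] Y) ⊕[ p ᶜ ] s                 ≈⟨ ⊕-cong (p ᶜ) (⊕-swap v) ≈-refl ⟩
    (Y ⊕[ v ᶜ ] s) ⊕[ p ᶜ ] s               ≈⟨ ⊕-assoc (v ᶜ) (p ᶜ) ⟩
    Y ⊕[ v ᶜ · p ᶜ ] (s ⊕[ σ (v ᶜ) (p ᶜ) ] s) ≈⟨ ⊕-cong (v ᶜ · p ᶜ) ≈-refl (ax-P1 (σ (v ᶜ) (p ᶜ))) ⟩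
    Y ⊕[ v ᶜ · p ᶜ ] s                      ≈⟨ ⊕-swap (v ᶜ · p ᶜ) ⟩
    s ⊕[ (v ᶜ · p ᶜ) ᶜ ] Y                  ∎)

∧-true-l : ∀ {a b} → a ∧ b ≡ true → a ≡ true
∧-true-l {true} _ = refl

∧-true-r : ∀ {a b} → a ∧ b ≡ true → b ≡ true
∧-true-r {true} b≡true = b≡true

does-true : ∀ {A : Set} (d : Dec A) → does d ≡ true → A
does-true (yes a) _ = a

eqb-refl : ∀ {n} (P : Term n) → eqb P P ≡ true
eqb-refl 𝟎 = refl
eqb-refl (a ∙ P) rewrite dec-true (a Fin.≟ a) refl = eqb-refl P
eqb-refl (P ⊓ Q) rewrite eqb-refl P = eqb-refl Q
eqb-refl (P □ Q) rewrite eqb-refl P = eqb-refl Q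
eqb-refl (P ⊕[ p ] Q) rewrite dec-true (val p ℚP.≟ val p) refl | eqb-refl P = eqb-refl Q

eqb-sound : ∀ {n} (P Q : Term n) → eqb P Q ≡ true → P ≡ Q
eqb-sound 𝟎 𝟎 _ = refl
eqb-sound (a ∙ P) (b ∙ Q) e =
  cong₂ _∙_ (does-true (a Fin.≟ b) (∧-true-l e)) (eqb-sound P Q (∧-true-r e))
eqb-sound (P ⊓ Q) (P' ⊓ Q') e =
  cong₂ _⊓_ (eqb-sound P P' (∧-true-l e)) (eqb-sound Q Q' (∧-true-r e))
eqb-sound (P □ Q) (P' □ Q') e =
  cong₂ _□_ (eqb-sound P P' (∧-true-l e)) (eqb-sound Q Q' (∧-true-r e))
eqb-sound (P ⊕[ p ] Q) (P' ⊕[ p' ] Q') e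
  with prob-ext {p} {p'} (does-true (val p ℚP.≟ val p') (∧-true-l e))
... | refl = cong₂ (_⊕[ p ]_) (eqb-sound P P' (∧-true-l rest)) (eqb-sound Q Q' (∧-true-r rest))
  where
  rest : eqb P P' ∧ eqb Q Q' ≡ true
  rest = ∧-true-r {does (val p ℚP.≟ val p)} e
eqb-sound 𝟎 (_ ∙ _) ()
eqb-sound 𝟎 (_ ⊓ _) ()
eqb-sound 𝟎 (_ □ _) ()
eqb-sound 𝟎 (_ ⊕[ _ ] _) ()
eqb-sound (_ ∙ _) 𝟎 ()
eqb-sound (_ ∙ _) (_ ⊓ _) ()
eqb-sound (_ ∙ _) (_ □ _) ()
eqb-sound (_ ∙ _) (_ ⊕[ _ ] _) ()
eqb-sound (_ ⊓ _) 𝟎 ()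
eqb-sound (_ ⊓ _) (_ ∙ _) ()
eqb-sound (_ ⊓ _) (_ □ _) ()
eqb-sound (_ ⊓ _) (_ ⊕[ _ ] _) ()
eqb-sound (_ □ _) 𝟎 ()
eqb-sound (_ □ _) (_ ∙ _) ()
eqb-sound (_ □ _) (_ ⊓ _) ()
eqb-sound (_ □ _) (_ ⊕[ _ ] _) ()
eqb-sound (_ ⊕[ _ ] _) 𝟎 ()
eqb-sound (_ ⊕[ _ ] _) (_ ∙ _) ()
eqb-sound (_ ⊕[ _ ] _) (_ ⊓ _) ()
eqb-sound (_ ⊕[ _ ] _) (_ □ _) ()

point : ∀ {n} {S : Term n} (t : Term n) → IsState S →
  ⟦ S ⟧ t ≡ (if eqb S t then 1ℚ else 0ℚ)
point t st-nil = refl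
point t (st-pre _) = refl
point t (st-int _ _) = refl
point t (st-ext _ _) = refl

point-self : ∀ {n} {s : Term n} → IsState s → ⟦ s ⟧ s ≡ 1ℚ
point-self {s = s} hs = trans (point s hs) (cong (if_then 1ℚ else 0ℚ) (eqb-refl s))

data Absent {n : ℕ} (s : Term n) : Term n → Set where
  absent-state : ∀ {S} → IsState S → eqb S s ≡ false → Absent s S
  absent-⊕     : ∀ {A B p} → Absent s A → Absent s B → Absent s (A ⊕[ p ] B)

absent⇒0 : ∀ {n} {s X : Term n} → Absent s X → ⟦ X ⟧ s ≡ 0ℚ
absent⇒0 {s = s} (absent-state hS S≢s) = trans (point s hS) (cong (if_then 1ℚ else 0ℚ) S≢s)
absent⇒0 (absent-⊕ {p = p} a b) rewrite absent⇒0 a | absent⇒0 b =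
  solve 1 (λ p → p :* con 0ℚ :+ (con 1ℚ :- p) :* con 0ℚ := con 0ℚ) refl (val p)

present : ∀ {n} {S : Term n} → IsState S → ¬ Absent S S
present {S = S} _ (absent-state _ S≢S) = true≢false (trans (sym (eqb-refl S)) S≢S)
  where
  true≢false : true ≡ false → ⊥
  true≢false ()
present () (absent-⊕ _ _)

leaf : ∀ {n} {P : Term n} → IsProc P → Σ (Term n) λ s → IsState s × ¬ Absent s P
leaf (pr-st {S} hS) = S , hS , present hS
leaf (pr-prob hA hB) with leaf hA
... | s , hs , s∈A = s , hs , λ { (absent-⊕ a _) → s∈A a }

leaves : ∀ {n} → Term n → ℕ
leaves (A ⊕[ _ ] B) = leaves A ℕ.+ leaves B
leaves _ = 1

leaves-pos : ∀ {n} (P : Term n) → 0 ℕ.< leaves P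
leaves-pos 𝟎 = ℕ.s≤s ℕ.z≤n
leaves-pos (_ ∙ _) = ℕ.s≤s ℕ.z≤n
leaves-pos (_ ⊓ _) = ℕ.s≤s ℕ.z≤n
leaves-pos (_ □ _) = ℕ.s≤s ℕ.z≤n
leaves-pos (A ⊕[ _ ] B) = ℕP.<-≤-trans (leaves-pos A) (ℕP.m≤m+n (leaves A) (leaves B))

data Split {n : ℕ} (s X : Term n) : Set where
  absent : Absent s X → Split s X
  pure   : X ≈ s → Split s X
  mixed  : ∀ {X'} → IsProc X' → Absent s X' → leaves X' ℕ.< leaves X → Mix s X' X →
           Split s X

split-⊕ : ∀ {n} {s A B : Term n} p → IsProc A → IsProc B →
  Split s A → Split s B → Split s (A ⊕[ p ] B)
split-⊕ p hA hB (absent a) (absent b) = absent (absent-⊕ a b)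
split-⊕ {A = A} {B} p hA hB (absent a) (pure B≈s) =
  mixed hA a (ℕP.m<m+n (leaves A) (leaves-pos B))
    (p ᶜ , ≈-trans (⊕-cong p ≈-refl B≈s) (⊕-swap p))
split-⊕ {A = A} p hA hB (absent a) (mixed hB' b lt mB) =
  let (_ , m) = mix-right {A = A} p mB
  in mixed (pr-prob hA hB') (absent-⊕ a b) (ℕP.+-monoʳ-< (leaves A) lt) m
split-⊕ {A = A} {B} p hA hB (pure A≈s) (absent b) =
  mixed hB b (ℕP.m<n+m (leaves B) (leaves-pos A)) (p , ⊕-cong p A≈s ≈-refl)
split-⊕ p hA hB (pure A≈s) (pure B≈s) = pure (≈-trans (⊕-cong p A≈s B≈s) (ax-P1 p))
split-⊕ {A = A} {B} p hA hB (pure A≈s) (mixed hB' b lt mB) =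
  mixed hB' b (ℕP.<-≤-trans lt (ℕP.m≤n+m (leaves B) (leaves A)))
    (mix-resp (⊕-cong p A≈s ≈-refl) (absorb p mB))
split-⊕ {B = B} p hA hB (mixed hA' a lt mA) (absent b) =
  let (_ , m) = mix-left {B = B} p mA
  in mixed (pr-prob hA' hB) (absent-⊕ a b) (ℕP.+-monoˡ-< (leaves B) lt) m
split-⊕ {A = A} {B} p hA hB (mixed hA' a lt mA) (pure B≈s) =
  mixed hA' a (ℕP.<-≤-trans lt (ℕP.m≤m+n (leaves A) (leaves B)))
    (mix-resp (≈-trans (⊕-cong p ≈-refl B≈s) (⊕-swap p)) (absorb (p ᶜ) mA))
split-⊕ {B = B} p hA hB (mixed hA' a ltA mA) (mixed hB' b ltB mB) =
  let (u , w , A⊕B≈s⊕[A'⊕B]) = mix-left {B = B} p mA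
      (_ , m) = mix-right u mB
  in mixed (pr-prob hA' hB') (absent-⊕ a b) (ℕP.+-mono-< ltA ltB)
       (mix-resp A⊕B≈s⊕[A'⊕B] (absorb w m))

split : ∀ {n} (s : Term n) {X : Term n} → IsProc X → Split s X
split s (pr-st {S} hS) with eqb S s in S≟s
... | true  = pure (subst (S ≈_) (eqb-sound S s S≟s) ≈-refl)
... | false = absent (absent-state hS S≟s)
split s (pr-prob {p = p} hA hB) = split-⊕ p hA hB (split s hA) (split s hB)

weight : ∀ {n} {s X : Term n} → Split s X → ℚ
weight (absent _) = 0ℚ
weight (pure _) = 1ℚ
weight (mixed _ _ _ (w , _)) = val w

weight-correct : ∀ {n} {s X : Term n} → IsState s → (sp : Split s X) → ⟦ X ⟧ s ≡ weight sp
weight-correct hs (absent a) = absent⇒0 a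
weight-correct {s = s} hs (pure X≈s) = trans (≈-sound X≈s s) (point-self hs)
weight-correct {s = s} {X} hs (mixed {X'} _ a _ (w , X≈s⊕X')) = begin
  ⟦ X ⟧ s                                  ≡⟨ ≈-sound X≈s⊕X' s ⟩
  val w * ⟦ s ⟧ s + (1ℚ - val w) * ⟦ X' ⟧ s ≡⟨ cong₂ (λ x y → val w * x + (1ℚ - val w) * y)
                                                     (point-self hs) (absent⇒0 a) ⟩
  val w * 1ℚ + (1ℚ - val w) * 0ℚ           ≡⟨ solve 1 (λ w → w :* con 1ℚ :+ (con 1ℚ :- w) :* con 0ℚ := w)
                                                     refl (val w) ⟩
  val w                                    ∎
  where open ≡-Reasoning

SameDist : ∀ {n} → Term n → Term n → Set
SameDist {n} P Q = ∀ (t : Term n) → IsState t → ⟦ P ⟧ t ≡ ⟦ Q ⟧ t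

residuals-agree : ∀ {n} {s X X' Y Y' : Term n} {w : Prob} →
  X ≈ s ⊕[ w ] X' → Y ≈ s ⊕[ w ] Y' → SameDist X Y → SameDist X' Y'
residuals-agree {s = s} {X' = X'} {Y' = Y'} {w} X≈s⊕X' Y≈s⊕Y' X~Y t ht =
  *-cancelˡ-nonZero (1ℚ - val w) (⟦ X' ⟧ t) (⟦ Y' ⟧ t)
    {{>-nonZero (1-p-pos (prob-<1 w))}}
    (ℚ+.∙-cancelˡ (val w * ⟦ s ⟧ t) _ _
      (trans (sym (≈-sound X≈s⊕X' t)) (trans (X~Y t ht) (≈-sound Y≈s⊕Y' t))))

weights-agree : ∀ {n} {s P Q : Term n} → IsState s → SameDist P Q →
  (sP : Split s P) (sQ : Split s Q) → weight sP ≡ weight sQ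
weights-agree {s = s} hs P~Q sP sQ =
  trans (sym (weight-correct hs sP)) (trans (P~Q s hs) (weight-correct hs sQ))

complete : ∀ {n} {P Q : Term n} → IsProc P → IsProc Q → Acc ℕ._<_ (leaves P) →
  SameDist P Q → P ≈ Q
complete {P = P} {Q} hP hQ (acc smaller) P~Q with leaf hP
... | s , hs , s∈P = match (split s hP) (split s hQ) (weights-agree hs P~Q (split s hP) (split s hQ))
  where
  match : (sP : Split s P) (sQ : Split s Q) → weight sP ≡ weight sQ → P ≈ Q
  match (absent s∉P) _ _ = ⊥-elim (s∈P s∉P)
  match (pure P≈s) (pure Q≈s) _ = ≈-trans P≈s (≈-sym Q≈s)
  match (pure _) (absent _) 1≡0 = ⊥-elim (1≢0 1≡0)
  match (pure _) (mixed _ _ _ (v , _)) 1≡v = ⊥-elim (prob≢1 v (sym 1≡v))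
  match (mixed _ _ _ (w , _)) (absent _) w≡0 = ⊥-elim (prob≢0 w w≡0)
  match (mixed _ _ _ (w , _)) (pure _) w≡1 = ⊥-elim (prob≢1 w w≡1)
  match (mixed {P'} hP' _ lt (w , P≈s⊕P')) (mixed {Q'} hQ' _ _ (v , Q≈s⊕Q')) w≡v
    with prob-ext {w} {v} w≡v
  ... | refl = ≈-trans P≈s⊕P' (≈-trans (⊕-cong w ≈-refl P'≈Q') (≈-sym Q≈s⊕Q'))
    where
    P'≈Q' : P' ≈ Q'
    P'≈Q' = complete hP' hQ' (smaller lt) (residuals-agree P≈s⊕P' Q≈s⊕Q' P~Q)

lemma9p4 : ∀ {n : ℕ} (P Q : Term n) → IsProc P → IsProc Q →
    (∀ (s : Term n) → IsState s → ⟦ P ⟧ s ≡ ⟦ Q ⟧ s) →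
    P =prob Q
lemma9p4 P Q hP hQ P~Q = ≈⇒=prob (complete hP hQ (<-wellFounded (leaves P)) P~Q)
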